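{- For every integer $t\geq0$, $x_{2^t}^{(3)}=3\cdot 2^t$.
   Context: For a positive integer $m$, let $\nu_2(m)$ be the exponent of the highest power of $2$ dividing $m$. Define $x_1^{(3)}=3$ and, for $n\ge2$, $x_n^{(3)}$ is the smallest integer $y>x_{n-1}^{(3)}$ with $\nu_2(y)=\nu_2(n)$. -}

module Defs where

open import Data.Nat using (ℕ; zero; suc; _+_; _*_; _^_; _<_; _≤_)
open import Data.Nat.Divisibility using (_∣_)
open import Relation.Nullary using (¬_)

-- ν₂ m ≡ k, as a relation: 2^k is the highest power of 2 dividing m
-- (only meaningful for m > 0, which is all we use it for).
record HasVal2 (m k : ℕ) : Set where
  field
    divides    : 2 ^ k ∣ m
    notDivides : ¬ (2 ^ suc k ∣ m)

SameVal2 : ℕ → ℕ → Set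
SameVal2 y n = ∀ k → HasVal2 n k → HasVal2 y k

-- X n y  means  x_n^{(3)} = y.
-- x_1 = 3; for n ≥ 2, x_n is the smallest integer y > x_{n-1} with ν₂(y) = ν₂(n).
data X : ℕ → ℕ → Set where
  X-one  : X 1 3
  X-step : ∀ {n p y} → X (suc n) p →
           p < y →
           SameVal2 y (suc (suc n)) →
           (∀ z → p < z → z < y → ¬ SameVal2 z (suc (suc n))) →
           X (suc (suc n)) y

{-# OPTIONS --safe #-}
module Submission where

-- Write P = 2^t and Q = 2P. Below Q, adding Q does not change
-- 2-adic valuations, so from x_P = 3P = P + Q the sequence just counts up:
-- x_m = m + Q for P ≤ m < Q, each candidate m + Q being admissible and
-- trivially minimal. The last step lands on index Q, where the values
-- ≥ Q + Q with valuation ν₂(Q) below 3Q are multiples of Q in [2Q, 3Q), i.e.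
-- only 2Q, whose valuation is too large; so x_Q = 3Q.

open import Defs
open import Data.Nat using (ℕ; zero; suc; pred; s≤s; z≤n; _+_; _*_; _^_; _<_; _≤_; _∸_; NonZero; >-nonZero)
open import Data.Nat.Properties
open import Data.Nat.Divisibility
open import Relation.Nullary using (¬_)
open import Function using (_∘_)
open import Relation.Binary.PropositionalEquality

^-monoʳ-∣ : ∀ m {i j} → i ≤ j → m ^ i ∣ m ^ j
^-monoʳ-∣ m {i} {j} i≤j = divides (m ^ (j ∸ i)) (begin
  m ^ j                ≡⟨ cong (m ^_) (sym (m+[n∸m]≡n i≤j)) ⟩
  m ^ (i + (j ∸ i))    ≡⟨ ^-distribˡ-+-* m i (j ∸ i) ⟩
  m ^ i * m ^ (j ∸ i)  ≡⟨ *-comm (m ^ i) (m ^ (j ∸ i)) ⟩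
  m ^ (j ∸ i) * m ^ i  ∎)
  where open ≡-Reasoning

multiple-squeeze : ∀ {d z} c .{{_ : NonZero d}} →
                   d ∣ z → c * d ≤ z → z < suc c * d → z ≡ c * d
multiple-squeeze {d} c (divides q refl) cd≤qd qd<[1+c]d =
  cong (_* d) (≤-antisym (≤-pred (*-cancelʳ-< d q (suc c) qd<[1+c]d))
                         (*-cancelʳ-≤ c q d cd≤qd))

HasVal2-pow : ∀ k → HasVal2 (2 ^ k) k
HasVal2-pow k = record
  { divides    = ∣-refl
  ; notDivides = λ d → <⇒≱ (^-monoʳ-< 2 (n<1+n 1) (n<1+n k))
                           (∣⇒≤ {{m^n≢0 2 k}} d)
  }

HasVal2-+-pow : ∀ {n j} s → 0 < n → n < 2 ^ s → HasVal2 n j → HasVal2 (n + 2 ^ s) j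
HasVal2-+-pow {n} {j} s n>0 n<2^s v = record
  { divides    = ∣m∣n⇒∣m+n (HasVal2.divides v) (^-monoʳ-∣ 2 (<⇒≤ j<s))
  ; notDivides = λ d → HasVal2.notDivides v
      (∣m+n∣m⇒∣n (subst (2 ^ suc j ∣_) (+-comm n (2 ^ s)) d) (^-monoʳ-∣ 2 j<s))
  }
  where
  j<s : j < s
  j<s = ≰⇒> λ s≤j → <⇒≱ (≤-<-trans (∣⇒≤ {{>-nonZero n>0}} (HasVal2.divides v)) n<2^s)
                        (^-monoʳ-≤ 2 s≤j)

SameVal2-+-pow : ∀ {n} s → 0 < n → n < 2 ^ s → SameVal2 (n + 2 ^ s) n
SameVal2-+-pow s n>0 n<2^s j = HasVal2-+-pow s n>0 n<2^s

X-step′ : ∀ {n p y} → X n p → p < y → SameVal2 y (suc n) →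
          (∀ z → p < z → z < y → ¬ SameVal2 z (suc n)) → X (suc n) y
X-step′ x@X-one            = X-step x
X-step′ x@(X-step _ _ _ _) = X-step x

X-suc : ∀ {n p} → X n p → SameVal2 (suc p) (suc n) → X (suc n) (suc p)
X-suc x v = X-step′ x (n<1+n _) v λ z p<z z<1+p _ → <⇒≱ z<1+p p<z

X-run : ∀ {n p} K → X n p → (∀ {k} → k < K → SameVal2 (suc k + p) (suc k + n)) →
        X (K + n) (K + p)
X-run zero    x v = x
X-run (suc K) x v = X-suc (X-run K x (v ∘ m<n⇒m<1+n)) (v (n<1+n K))

-- A competitor z ∈ (n + Q, 3Q) = [2Q, 3Q) with ν₂(z) = s is a multiple of Q,
-- hence z = 2Q = 2^(s+1), whose valuation is s + 1.
X-reach-pow : ∀ s {n} → suc n ≡ 2 ^ s → X n (n + 2 ^ s) → X (2 ^ s) (3 * 2 ^ s)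
X-reach-pow s {n} 1+n≡Q x =
  subst (λ m → X m (3 * Q)) 1+n≡Q
    (X-step′ x n+Q<3Q (subst (SameVal2 (3 * Q)) (sym 1+n≡Q) (SameVal2-+-pow (suc s) Q>0 Q<2Q))
       λ z n+Q<z z<3Q v → minimal z (n+Q<z) z<3Q (subst (SameVal2 z) 1+n≡Q v))
  where
  Q = 2 ^ s
  instance
    _ : NonZero Q
    _ = m^n≢0 2 s
  Q>0 : 0 < Q
  Q>0 = m^n>0 2 s
  Q<2Q : Q < 2 ^ suc s
  Q<2Q = ^-monoʳ-< 2 (n<1+n 1) (n<1+n s)
  2Q≡1+n+Q : 2 * Q ≡ suc (n + Q)
  2Q≡1+n+Q = trans (cong (Q +_) (+-identityʳ Q)) (cong (_+ Q) (sym 1+n≡Q))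
  n+Q<3Q : n + Q < 3 * Q
  n+Q<3Q = subst (_≤ 3 * Q) 2Q≡1+n+Q (m≤n+m (2 * Q) Q)
  minimal : ∀ z → n + Q < z → z < 3 * Q → ¬ SameVal2 z Q
  minimal z n+Q<z z<3Q v = HasVal2.notDivides vz (∣-reflexive (sym z≡2Q))
    where
    vz : HasVal2 z s
    vz = v s (HasVal2-pow s)
    z≡2Q : z ≡ 2 * Q
    z≡2Q = multiple-squeeze 2 (HasVal2.divides vz) (subst (_≤ z) (sym 2Q≡1+n+Q) n+Q<z) z<3Q

X-double : ∀ t → X (2 ^ t) (3 * 2 ^ t) → X (2 ^ suc t) (3 * 2 ^ suc t)
-- x : X P (3 * P) already has the shape X P (P + Q), since 3 * P unfolds to P + 2 * P.
X-double t x =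
  X-reach-pow (suc t) 1+b+P≡Q (subst (X (b + P)) (sym (+-assoc b P Q)) (X-run b x shifted))
  where
  P = 2 ^ t
  Q = 2 ^ suc t
  b = pred P
  1+b≡P : suc b ≡ P
  1+b≡P = suc-pred P {{m^n≢0 2 t}}
  P+P≡Q : P + P ≡ Q
  P+P≡Q = cong (P +_) (sym (+-identityʳ P))
  1+b+P≡Q : suc (b + P) ≡ Q
  1+b+P≡Q = trans (cong (_+ P) 1+b≡P) P+P≡Q
  shifted : ∀ {k} → k < b → SameVal2 (suc k + (P + Q)) (suc k + P)
  shifted {k} k<b = subst (λ y → SameVal2 y (suc k + P)) (+-assoc (suc k) P Q)
    (SameVal2-+-pow (suc t) (s≤s z≤n)
      (subst (suc k + P <_) P+P≡Q (+-monoˡ-< P (subst (suc k <_) 1+b≡P (s≤s k<b)))))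

lemma1 : (t : ℕ) → X (2 ^ t) (3 * 2 ^ t)
lemma1 zero    = X-one
lemma1 (suc t) = X-double t (lemma1 t)
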